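{- Let $F=\{f_1,\dots,f_m\}$ be a set of homogeneous polynomials in $\mathbb{Z}[x_1,\dots,x_k]$, let $a_1,\dots,a_k\in\mathbb{Z}$, $n\ge 1$, and let $b\in\mathbb{Z}$ with $\gcd(b,n)=1$. Let $g_k(b,n)$ denote the number of $(x_1,\dots,x_k)\in\mathbb{Z}_n^k$ with $a_1x_1+\dots+a_kx_k\equiv b\pmod n$ and $\gcd(f_i(x_1,\dots,x_k),n)=1$ for each $1\le i\le m$. Then \[ g_k(b,n)=\frac{\phi_{F'}(n)}{\varphi(n)},\qquad F'=F\cup\{a_1x_1+\dots+a_kx_k\}. \]
   Context: For a finite set $G=\{g_1,\dots,g_r\}$ of polynomials in $\mathbb{Z}[x_1,\dots,x_k]$, $\phi_G(n)$ is the number of $(x_1,\dots,x_k)\in\mathbb{Z}_n^k$ with $\gcd(g_i(x_1,\dots,x_k),n)=1$ for every $i$. $\varphi$ is Euler's totient function. -}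

module Defs where

open import Data.Nat as ℕ using (ℕ; zero; suc)
open import Data.Nat.Coprimality using (Coprime; coprime?)
open import Data.Nat.Divisibility using (_∣?_)
open import Data.Integer as ℤ using (ℤ; +_; ∣_∣)
open import Data.Fin using (Fin; toℕ)
open import Data.Vec using (Vec; []; _∷_; lookup; tabulate; foldr)
open import Data.List as List using (List; []; _∷_; [_]; _++_; length; filter; allFin; concatMap; map)
open import Data.List.Relation.Unary.All using (All; all?)
open import Data.Product using (_×_; _,_; ∃)
open import Relation.Nullary using (Dec)
open import Relation.Nullary.Decidable using (_×-dec_)
open import Relation.Binary.PropositionalEquality using (_≡_)

-- A monomial term: integer coefficient and exponent vector.
Term : ℕ → Set
Term k = ℤ × Vec ℕ k

Poly : ℕ → Set
Poly k = List (Term k)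

degree : ∀ {k} → Vec ℕ k → ℕ
degree = foldr _ ℕ._+_ 0

Homogeneous : ∀ {k} → Poly k → Set
Homogeneous {k} f = ∃ λ d → All (λ t → Data.Product.proj₁ t ≡ + 0 ⊎' degree (Data.Product.proj₂ t) ≡ d) f
  where
  open import Data.Sum renaming (_⊎_ to _⊎'_)

_^ℤ_ : ℤ → ℕ → ℤ
x ^ℤ zero = + 1
x ^ℤ suc e = x ℤ.* (x ^ℤ e)

evalMono : ∀ {k} → Vec ℕ k → Vec ℤ k → ℤ
evalMono [] [] = + 1
evalMono (e ∷ es) (x ∷ xs) = (x ^ℤ e) ℤ.* evalMono es xs

eval : ∀ {k} → Poly k → Vec ℤ k → ℤ
eval [] x = + 0
eval ((c , e) ∷ f) x = c ℤ.* evalMono e x ℤ.+ eval f x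

lift : ∀ {k n} → Vec (Fin n) k → Vec ℤ k
lift = Data.Vec.map (λ i → + toℕ i)

tuples : (k n : ℕ) → List (Vec (Fin n) k)
tuples zero n = [ [] ]
tuples (suc k) n = concatMap (λ i → map (i ∷_) (tuples k n)) (allFin n)

unitExp : ∀ {k} → Fin k → Vec ℕ k
unitExp i = tabulate (λ j → if⌊ i Data.Fin.≟ j ⌋ 1 0)
  where
  open import Relation.Nullary.Decidable using (⌊_⌋)
  open import Data.Bool using (if_then_else_)
  if⌊_⌋ : ∀ {p} {P : Set p} → Dec P → ℕ → ℕ → ℕ
  if⌊ d ⌋ a b = if ⌊ d ⌋ then a else b

linear : ∀ {k} → Vec ℤ k → Poly k
linear {k} a = map (λ i → lookup a i , unitExp i) (allFin k)

AllCoprime : ∀ {k} → ℕ → List (Poly k) → Vec ℤ k → Set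
AllCoprime n G x = All (λ g → Coprime ∣ eval g x ∣ n) G

allCoprime? : ∀ {k} n (G : List (Poly k)) x → Dec (AllCoprime n G x)
allCoprime? n G x = all? (λ g → coprime? ∣ eval g x ∣ n) G

phiG : ∀ {k} → List (Poly k) → ℕ → ℕ
phiG {k} G n = length (filter (λ x → allCoprime? n G (lift x)) (tuples k n))

totient : ℕ → ℕ
totient n = length (filter (λ i → coprime? (toℕ i) n) (allFin n))

gCount : ∀ {k} → List (Poly k) → Vec ℤ k → ℤ → ℕ → ℕ
gCount {k} F a b n =
  length (filter (λ x → (n ∣? ∣ eval (linear a) (lift x) ℤ.- b ∣) ×-dec allCoprime? n F (lift x)) (tuples k n))

{-# OPTIONS --safe #-}
module Submission where

-- Multiplying every coordinate by a unit u of ℤ_n permutes ℤ_n^k. Since the f_i are homogeneous,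
-- f_i(u x) = u^{deg f_i} f_i(x) is a unit exactly when f_i(x) is, while a·x moves from c to u c.
-- Hence the number of x with a·x ≡ c and every f_i(x) a unit is the same for every unit c, and
-- splitting φ_{F'}(n) by the residue of a·x, which must itself be a unit, gives φ(n) such fibres.

open import Defs
open import Data.Nat as ℕ using (ℕ; zero; suc; _≤_; NonZero; >-nonZero)
import Data.Nat.Properties as ℕ
open import Data.Nat.ListAction using (sum)
open import Data.Nat.Divisibility as ℕ using (_∣?_; n∣m⇒m%n≡0)
open import Data.Nat.DivMod using (m<n⇒m%n≡m)
open import Data.Nat.Coprimality as Coprimality using (Coprime; coprime?; coprime-divisor; coprime-Bézout)
open import Data.Nat.GCD using (module Bézout)
open import Data.Integer as ℤ using (ℤ; ∣_∣; 0ℤ; 1ℤ)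
import Data.Integer.Properties as ℤ
import Data.Integer.Coprimality as ℤ
open import Data.Integer.Divisibility.Signed
  using (_∣_; divides; ∣m∣n⇒∣m+n; ∣m⇒∣-m; ∣n⇒∣m*n; ∣m⇒∣m*n; ∣ᵤ⇒∣; ∣⇒∣ᵤ; ∣-trans)
open import Data.Integer.DivMod using (_%ℕ_; _/ℕ_; n%ℕd<d; a≡a%ℕn+[a/ℕn]*n)
open import Data.Integer.Tactic.RingSolver using (solve-∀)
open import Data.Bool using (if_then_else_; true; false)
open import Data.Fin as Fin using (Fin; toℕ; fromℕ<)
import Data.Fin.Properties as Fin
open import Data.Vec as Vec using (Vec; []; _∷_; tabulate)
open import Data.Vec.Properties using (tabulate-cong)
open import Data.Vec.Relation.Binary.Pointwise.Inductive using (Pointwise; []; _∷_)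
open import Data.List using (List; []; _∷_; _++_; [_]; map; filter; length; allFin)
open import Data.List.Properties using (map-cong; filter-≐; filter-none; filter-accept; filter-reject)
open import Data.List.Relation.Unary.All as All using (All; []; _∷_)
import Data.List.Relation.Unary.All.Properties as All
open import Data.List.Relation.Unary.Any as Any using (here; there)
open import Data.List.Relation.Unary.AllPairs as AllPairs using ([]; _∷_)
import Data.List.Relation.Unary.AllPairs.Properties as AllPairs
open import Data.List.Relation.Unary.Unique.Propositional using (Unique)
import Data.List.Relation.Unary.Unique.Propositional.Properties as Unique
open import Data.List.Membership.Propositional using (_∈_)
open import Data.List.Membership.Propositional.Properties using (∈-map⁺; ∈-map⁻; ∈-concatMap⁺; ∈-allFin)
open import Data.List.Membership.Propositional.Properties.WithK using (unique∧set⇒bag)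
open import Data.List.Relation.Binary.BagAndSetEquality using (∼bag⇒↭)
open import Data.List.Relation.Binary.Permutation.Propositional using (_↭_)
open import Data.List.Relation.Binary.Permutation.Propositional.Properties using (↭-length; filter-↭)
open import Data.Product using (∃; _×_; _,_; proj₁; proj₂)
open import Data.Sum using (_⊎_; inj₁; inj₂)
open import Data.Empty using (⊥)
open import Algebra.Properties.CommutativeSemigroup ℕ.+-commutativeSemigroup using (interchange)
open import Function using (_∘_; _⇔_; mk⇔; Equivalence)
open import Level using (0ℓ)
open import Relation.Nullary using (Dec; does; yes; no; ¬_)
open import Relation.Nullary.Decidable using (_×-dec_; isYes≗does)
open import Relation.Unary using (Pred; Decidable; _⊆_; _≐_; ∁)
open import Relation.Binary.Bundles using (Setoid)
open import Relation.Binary.Definitions using (DecidableEquality)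
import Relation.Binary.Reasoning.Setoid as SetoidReasoning
open import Relation.Binary.PropositionalEquality hiding ([_])

module Counting where

  open import Data.Nat using (_+_; _*_)

  indicator : {P : Set} → Dec P → ℕ
  indicator P? = if does P? then 1 else 0

  count : {A : Set} {P : Pred A 0ℓ} → Decidable P → List A → ℕ
  count P? xs = length (filter P? xs)

  sum-map-+ : {A : Set} (f g : A → ℕ) (xs : List A) →
    sum (map (λ x → f x + g x) xs) ≡ sum (map f xs) + sum (map g xs)
  sum-map-+ f g [] = refl
  sum-map-+ f g (x ∷ xs) = trans (cong (f x + g x +_) (sum-map-+ f g xs)) (interchange (f x) (g x) _ _)

  module _ {A : Set} {P : Pred A 0ℓ} (P? : Decidable P) where

    count-∷ : ∀ x xs → count P? (x ∷ xs) ≡ indicator (P? x) + count P? xs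
    count-∷ x xs with does (P? x)
    ... | true = refl
    ... | false = refl

    count≡sum-indicator : ∀ xs → count P? xs ≡ sum (map (indicator ∘ P?) xs)
    count≡sum-indicator [] = refl
    count≡sum-indicator (x ∷ xs) = trans (count-∷ x xs) (cong (indicator (P? x) +_) (count≡sum-indicator xs))

    count-none : ∀ {xs} → All (∁ P) xs → count P? xs ≡ 0
    count-none ¬Pxs = cong length (filter-none P? ¬Pxs)

    sum-indicator-* : ∀ K xs → sum (map (λ x → indicator (P? x) * K) xs) ≡ count P? xs * K
    sum-indicator-* K [] = refl
    sum-indicator-* K (x ∷ xs) = begin
      indicator (P? x) * K + sum (map (λ x → indicator (P? x) * K) xs)
        ≡⟨ cong (indicator (P? x) * K +_) (sum-indicator-* K xs) ⟩
      indicator (P? x) * K + count P? xs * K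
        ≡⟨ ℕ.*-distribʳ-+ K (indicator (P? x)) _ ⟨
      (indicator (P? x) + count P? xs) * K
        ≡⟨ cong (_* K) (count-∷ x xs) ⟨
      count P? (x ∷ xs) * K ∎
      where open ≡-Reasoning

    count-map : {B : Set} (f : B → A) (xs : List B) → count P? (map f xs) ≡ count (P? ∘ f) xs
    count-map f [] = refl
    count-map f (x ∷ xs) with does (P? (f x))
    ... | true = cong suc (count-map f xs)
    ... | false = count-map f xs

  count-cong : {A : Set} {P Q : Pred A 0ℓ} (P? : Decidable P) (Q? : Decidable Q) → P ≐ Q →
    ∀ xs → count P? xs ≡ count Q? xs
  count-cong P? Q? P≐Q xs = cong length (filter-≐ P? Q? P≐Q xs)

  count-bijection : {A : Set} {P : Pred A 0ℓ} (P? : Decidable P) {xs : List A} → Unique xs → (∀ x → x ∈ xs) →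
    (σ τ : A → A) → (∀ x → τ (σ x) ≡ x) → (∀ x → σ (τ x) ≡ x) → count P? xs ≡ count (P? ∘ σ) xs
  count-bijection P? {xs} xs-unique ∈-xs σ τ τσ στ =
    trans (↭-length (filter-↭ P? xs↭σxs)) (count-map P? σ xs)
    where
    σ-injective : ∀ {x y} → σ x ≡ σ y → x ≡ y
    σ-injective {x} {y} σx≡σy = trans (sym (τσ x)) (trans (cong τ σx≡σy) (τσ y))
    ∈-σxs : ∀ x → x ∈ map σ xs
    ∈-σxs x = subst (_∈ map σ xs) (στ x) (∈-map⁺ σ (∈-xs (τ x)))
    xs↭σxs : xs ↭ map σ xs
    xs↭σxs = ∼bag⇒↭ (unique∧set⇒bag xs-unique (Unique.map⁺ σ-injective xs-unique)
                                    (λ {x} → mk⇔ (λ _ → ∈-σxs x) (λ _ → ∈-xs x)))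

  module _ {A : Set} (_≟_ : DecidableEquality A) where

    count-≟-unique : ∀ {y cs} → Unique cs → y ∈ cs → count (y ≟_) cs ≡ 1
    count-≟-unique {y} (y≢cs ∷ _) (here refl) =
      trans (cong length (filter-accept (y ≟_) refl)) (cong suc (count-none (y ≟_) y≢cs))
    count-≟-unique {y} (c≢cs ∷ cs-unique) (there y∈cs) =
      trans (cong length (filter-reject (y ≟_) (λ y≡c → All.lookup c≢cs y∈cs (sym y≡c)))) (count-≟-unique cs-unique y∈cs)

    count-partition : {B : Set} {P : Pred B 0ℓ} (P? : Decidable P) (h : B → A) {cs : List A} →
      Unique cs → (∀ y → y ∈ cs) →
      ∀ xs → count P? xs ≡ sum (map (λ c → count (λ x → P? x ×-dec (h x ≟ c)) xs) cs)
    count-partition {B} {P} P? h {cs} cs-unique ∈-cs = go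
      where
      fibre-count : A → List B → ℕ
      fibre-count c = count (λ x → P? x ×-dec (h x ≟ c))

      indicator-in-one-fibre : ∀ x → sum (map (λ c → indicator (P? x ×-dec (h x ≟ c))) cs) ≡ indicator (P? x)
      indicator-in-one-fibre x = trans (sym (count≡sum-indicator (λ c → P? x ×-dec (h x ≟ c)) cs)) (by-cases (P? x))
        where
        by-cases : (Px? : Dec (P x)) → count (λ c → Px? ×-dec (h x ≟ c)) cs ≡ indicator Px?
        by-cases (yes Px) =
          trans (count-cong _ (h x ≟_) (proj₂ , (Px ,_)) cs) (count-≟-unique cs-unique (∈-cs (h x)))
        by-cases (no ¬Px) = count-none _ (All.universal (λ _ → ¬Px ∘ proj₁) cs)

      go : ∀ xs → count P? xs ≡ sum (map (λ c → fibre-count c xs) cs)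
      go [] = sym (sum-zeros cs)
        where
        sum-zeros : ∀ cs → sum (map (λ _ → 0) cs) ≡ 0
        sum-zeros [] = refl
        sum-zeros (_ ∷ cs) = sum-zeros cs
      go (x ∷ xs) = begin
        count P? (x ∷ xs)
          ≡⟨ count-∷ P? x xs ⟩
        indicator (P? x) + count P? xs
          ≡⟨ cong₂ _+_ (sym (indicator-in-one-fibre x)) (go xs) ⟩
        sum (map (λ c → indicator (P? x ×-dec (h x ≟ c))) cs) + sum (map (λ c → fibre-count c xs) cs)
          ≡⟨ sum-map-+ (λ c → indicator (P? x ×-dec (h x ≟ c))) (λ c → fibre-count c xs) cs ⟨
        sum (map (λ c → indicator (P? x ×-dec (h x ≟ c)) + fibre-count c xs) cs)
          ≡⟨ cong sum (map-cong (λ c → count-∷ (λ x → P? x ×-dec (h x ≟ c)) x xs) cs) ⟨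
        sum (map (λ c → fibre-count c (x ∷ xs)) cs) ∎
        where open ≡-Reasoning

open Counting
open import Data.Integer using (+_; _+_; _*_; _-_; -_)

∈-tuples : ∀ {k n} (x : Vec (Fin n) k) → x ∈ tuples k n
∈-tuples []      = here refl
∈-tuples {suc k} {n} (i ∷ x) =
  ∈-concatMap⁺ (λ j → map (j ∷_) (tuples k n))
               (Any.map (λ { refl → ∈-map⁺ (i ∷_) (∈-tuples x) }) (∈-allFin i))

tuples-unique : ∀ k n → Unique (tuples k n)
tuples-unique zero    n = [] ∷ []
tuples-unique (suc k) n =
  Unique.concat⁺ (All.map⁺ (All.tabulate⁺ (λ i → Unique.map⁺ (cong Vec.tail) (tuples-unique k n))))
                 (AllPairs.map⁺ (AllPairs.map disjoint (Unique.allFin⁺ n)))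
  where
  disjoint : ∀ {i j : Fin n} → i ≢ j →
             ∀ {x} → x ∈ map (i ∷_) (tuples k n) × x ∈ map (j ∷_) (tuples k n) → ⊥
  disjoint {i} {j} i≢j (x∈i∷ , x∈j∷) with ∈-map⁻ (i ∷_) x∈i∷ | ∈-map⁻ (j ∷_) x∈j∷
  ... | _ , _ , refl | _ , _ , i∷y≡j∷z = i≢j (cong Vec.head i∷y≡j∷z)

HomogeneousOfDegree : ∀ {k} → ℕ → Poly k → Set
HomogeneousOfDegree d = All (λ t → proj₁ t ≡ + 0 ⊎ degree (proj₂ t) ≡ d)

^ℤ-distribˡ-+-* : ∀ x d e → x ^ℤ (d ℕ.+ e) ≡ x ^ℤ d * x ^ℤ e
^ℤ-distribˡ-+-* x zero    e = sym (ℤ.*-identityˡ _)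
^ℤ-distribˡ-+-* x (suc d) e = trans (cong (x *_) (^ℤ-distribˡ-+-* x d e)) (sym (ℤ.*-assoc x _ _))

^ℤ-distribʳ-* : ∀ x y d → (x * y) ^ℤ d ≡ x ^ℤ d * y ^ℤ d
^ℤ-distribʳ-* x y zero    = refl
^ℤ-distribʳ-* x y (suc d) = trans (cong (x * y *_) (^ℤ-distribʳ-* x y d)) (lemma x y (x ^ℤ d) (y ^ℤ d))
  where
  lemma : ∀ x y X Y → x * y * (X * Y) ≡ x * X * (y * Y)
  lemma = solve-∀

evalMono-scale : ∀ {k} u (e : Vec ℕ k) ys → evalMono e (Vec.map (u *_) ys) ≡ u ^ℤ degree e * evalMono e ys
evalMono-scale u []      []       = refl
evalMono-scale u (d ∷ e) (y ∷ ys) = begin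
  (u * y) ^ℤ d * evalMono e (Vec.map (u *_) ys)
    ≡⟨ cong₂ _*_ (^ℤ-distribʳ-* u y d) (evalMono-scale u e ys) ⟩
  u ^ℤ d * y ^ℤ d * (u ^ℤ degree e * evalMono e ys)
    ≡⟨ lemma (u ^ℤ d) (y ^ℤ d) (u ^ℤ degree e) (evalMono e ys) ⟩
  u ^ℤ d * u ^ℤ degree e * (y ^ℤ d * evalMono e ys)
    ≡⟨ cong (_* _) (^ℤ-distribˡ-+-* u d (degree e)) ⟨
  u ^ℤ (d ℕ.+ degree e) * (y ^ℤ d * evalMono e ys) ∎
  where
  open ≡-Reasoning
  lemma : ∀ a b c m → a * b * (c * m) ≡ a * c * (b * m)
  lemma = solve-∀

eval-scale : ∀ {k} {d} {f : Poly k} → HomogeneousOfDegree d f → ∀ u ys →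
  eval f (Vec.map (u *_) ys) ≡ u ^ℤ d * eval f ys
eval-scale {d = d} [] u ys = sym (ℤ.*-zeroʳ (u ^ℤ d))
eval-scale {d = d} {(c , e) ∷ f} (inj₁ refl ∷ hom) u ys = begin
  + 0 + eval f (Vec.map (u *_) ys)  ≡⟨ ℤ.+-identityˡ _ ⟩
  eval f (Vec.map (u *_) ys)        ≡⟨ eval-scale hom u ys ⟩
  u ^ℤ d * eval f ys                ≡⟨ cong (u ^ℤ d *_) (ℤ.+-identityˡ _) ⟨
  u ^ℤ d * (+ 0 + eval f ys)        ∎
  where open ≡-Reasoning
eval-scale {f = (c , e) ∷ f} (inj₂ refl ∷ hom) u ys = begin
  c * evalMono e (Vec.map (u *_) ys) + eval f (Vec.map (u *_) ys)
    ≡⟨ cong₂ (λ m r → c * m + r) (evalMono-scale u e ys) (eval-scale hom u ys) ⟩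
  c * (u ^ℤ degree e * evalMono e ys) + u ^ℤ degree e * eval f ys
    ≡⟨ lemma c (u ^ℤ degree e) (evalMono e ys) (eval f ys) ⟩
  u ^ℤ degree e * (c * evalMono e ys + eval f ys) ∎
  where
  open ≡-Reasoning
  lemma : ∀ c a m r → c * (a * m) + a * r ≡ a * (c * m + r)
  lemma = solve-∀

degree-unitExp : ∀ {k} (i : Fin k) → degree (unitExp i) ≡ 1
degree-unitExp i = trans (cong degree unitExp≡unitVector) (degree-unitVector i)
  where
  -- unitExp tests i ≟ j with isYes, which is stuck on Fin.suc; restated with does, it computes.
  unitVector : ∀ {k} → Fin k → Vec ℕ k
  unitVector i = tabulate (λ j → if does (i Fin.≟ j) then 1 else 0)
  unitExp≡unitVector : unitExp i ≡ unitVector i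
  unitExp≡unitVector = tabulate-cong (λ j → cong (if_then 1 else 0) (isYes≗does (i Fin.≟ j)))
  degree-zeros : ∀ k → degree (tabulate {k} (λ _ → 0)) ≡ 0
  degree-zeros zero    = refl
  degree-zeros (suc k) = degree-zeros k
  degree-unitVector : ∀ {k} (i : Fin k) → degree (unitVector i) ≡ 1
  degree-unitVector {suc k} Fin.zero = cong suc (degree-zeros k)
  degree-unitVector (Fin.suc i)      = degree-unitVector i

linear-homogeneous : ∀ {k} (a : Vec ℤ k) → HomogeneousOfDegree 1 (linear a)
linear-homogeneous {k} a = All.map⁺ (All.universal (λ i → inj₂ (degree-unitExp i)) (allFin k))

module _ {n : ℕ} where

  coprime-*⁻ : ∀ u z → Coprime ∣ u * z ∣ n → Coprime ∣ z ∣ n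
  coprime-*⁻ u z uz⊥n (i∣z , i∣n) =
    uz⊥n (subst (_ ℕ.∣_) (sym (ℤ.abs-* u z)) (ℕ.∣n⇒∣m*n ∣ u ∣ i∣z) , i∣n)

  coprime-*⁺ : ∀ u z → Coprime ∣ u ∣ n → Coprime ∣ z ∣ n → Coprime ∣ u * z ∣ n
  coprime-*⁺ u z u⊥n z⊥n {i} (i∣uz , i∣n) =
    z⊥n (coprime-divisor i⊥u (subst (i ℕ.∣_) (ℤ.abs-* u z) i∣uz) , i∣n)
    where
    i⊥u : Coprime i ∣ u ∣
    i⊥u (j∣i , j∣u) = u⊥n (j∣u , ℕ.∣-trans j∣i i∣n)

  coprime-^ℤ : ∀ u d → Coprime ∣ u ∣ n → Coprime ∣ u ^ℤ d ∣ n
  coprime-^ℤ u zero    u⊥n = Coprimality.1-coprimeTo n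
  coprime-^ℤ u (suc d) u⊥n = coprime-*⁺ u (u ^ℤ d) u⊥n (coprime-^ℤ u d u⊥n)

pos-1+*≡* : ∀ a b c d → 1 ℕ.+ a ℕ.* b ≡ c ℕ.* d → 1ℤ + + a * + b ≡ + c * + d
pos-1+*≡* a b c d eq = begin
  1ℤ + + a * + b   ≡⟨ cong (λ m → 1ℤ + m) (ℤ.pos-* a b) ⟨
  + (1 ℕ.+ a ℕ.* b) ≡⟨ cong +_ eq ⟩
  + (c ℕ.* d)       ≡⟨ ℤ.pos-* c d ⟩
  + c * + d         ∎
  where open ≡-Reasoning

module Modulo (n : ℕ) .{{_ : NonZero n}} where

  -- A record rather than a synonym for + n ∣ z - w, so that z and w can be inferred from the type.
  infix 4 _≈_
  record _≈_ (z w : ℤ) : Set where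
    constructor mk≈
    field n∣z-w : + n ∣ z - w

  private
    n∣-subst : ∀ {x y} → x ≡ y → + n ∣ x → + n ∣ y
    n∣-subst = subst (+ n ∣_)

  ≈-refl : ∀ {z} → z ≈ z
  ≈-refl {z} = mk≈ (divides 0ℤ (ℤ.+-inverseʳ z))

  ≈-sym : ∀ {z w} → z ≈ w → w ≈ z
  ≈-sym {z} {w} (mk≈ n∣z-w) = mk≈ (n∣-subst (lemma z w) (∣m⇒∣-m n∣z-w))
    where
    lemma : ∀ z w → - (z - w) ≡ w - z
    lemma = solve-∀

  ≈-trans : ∀ {z w y} → z ≈ w → w ≈ y → z ≈ y
  ≈-trans {z} {w} {y} (mk≈ n∣z-w) (mk≈ n∣w-y) =
    mk≈ (n∣-subst (lemma z w y) (∣m∣n⇒∣m+n n∣z-w n∣w-y))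
    where
    lemma : ∀ z w y → (z - w) + (w - y) ≡ z - y
    lemma = solve-∀

  ≈-reflexive : ∀ {z w} → z ≡ w → z ≈ w
  ≈-reflexive refl = ≈-refl

  ≈-setoid : Setoid 0ℓ 0ℓ
  ≈-setoid = record
    { Carrier       = ℤ
    ; _≈_           = _≈_
    ; isEquivalence = record { refl = ≈-refl ; sym = ≈-sym ; trans = ≈-trans }
    }

  +-cong : ∀ {z z′ w w′} → z ≈ z′ → w ≈ w′ → z + w ≈ z′ + w′
  +-cong {z} {z′} {w} {w′} (mk≈ p) (mk≈ q) = mk≈ (n∣-subst (lemma z z′ w w′) (∣m∣n⇒∣m+n p q))
    where
    lemma : ∀ z z′ w w′ → (z - z′) + (w - w′) ≡ (z + w) - (z′ + w′)
    lemma = solve-∀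

  *-cong : ∀ {z z′ w w′} → z ≈ z′ → w ≈ w′ → z * w ≈ z′ * w′
  *-cong {z} {z′} {w} {w′} (mk≈ p) (mk≈ q) =
    mk≈ (n∣-subst (lemma z z′ w w′) (∣m∣n⇒∣m+n (∣m⇒∣m*n w p) (∣n⇒∣m*n z′ q)))
    where
    lemma : ∀ z z′ w w′ → (z - z′) * w + z′ * (w - w′) ≡ z * w - z′ * w′
    lemma = solve-∀

  module ≈-Reasoning = SetoidReasoning ≈-setoid

  ^ℤ-cong : ∀ {z w} d → z ≈ w → z ^ℤ d ≈ w ^ℤ d
  ^ℤ-cong zero    z≈w = ≈-refl
  ^ℤ-cong (suc d) z≈w = *-cong z≈w (^ℤ-cong d z≈w)

  ≈⇒∣ : ∀ {z w} → z ≈ w → n ℕ.∣ ∣ z - w ∣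
  ≈⇒∣ (mk≈ n∣z-w) = ∣⇒∣ᵤ n∣z-w

  ∣⇒≈ : ∀ {z w} → n ℕ.∣ ∣ z - w ∣ → z ≈ w
  ∣⇒≈ n∣z-w = mk≈ (∣ᵤ⇒∣ n∣z-w)

  ≈-coprime : ∀ {z w} → z ≈ w → Coprime ∣ z ∣ n → Coprime ∣ w ∣ n
  ≈-coprime {z} {w} (mk≈ n∣z-w) z⊥n {i} (i∣w , i∣n) = z⊥n (∣⇒∣ᵤ i∣z , i∣n)
    where
    lemma : ∀ z w → (z - w) + w ≡ z
    lemma = solve-∀
    i∣z : + i ∣ z
    i∣z = subst (+ i ∣_) (lemma z w) (∣m∣n⇒∣m+n (∣-trans (∣ᵤ⇒∣ i∣n) n∣z-w) (∣ᵤ⇒∣ i∣w))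

  *-cancelˡ-coprime : ∀ u {z w} → Coprime ∣ u ∣ n → u * z ≈ u * w → z ≈ w
  *-cancelˡ-coprime u {z} {w} u⊥n (mk≈ n∣uz-uw) =
    ∣⇒≈ (ℤ.coprime-divisor (+ n) u (z - w) (Coprimality.sym u⊥n)
                           (∣⇒∣ᵤ (n∣-subst (lemma u z w) n∣uz-uw)))
    where
    lemma : ∀ u z w → u * z - u * w ≡ u * (z - w)
    lemma = solve-∀

  residue : ℤ → Fin n
  residue z = fromℕ< (n%ℕd<d z n)

  residue-≈ : ∀ z → z ≈ + toℕ (residue z)
  residue-≈ z = mk≈ (divides (z /ℕ n) (begin
    z - + toℕ (residue z)                   ≡⟨ cong (λ r → z - + r) (Fin.toℕ-fromℕ< (n%ℕd<d z n)) ⟩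
    z - + (z %ℕ n)                          ≡⟨ cong (_- + (z %ℕ n)) (a≡a%ℕn+[a/ℕn]*n z n) ⟩
    + (z %ℕ n) + (z /ℕ n) * + n - + (z %ℕ n) ≡⟨ lemma (+ (z %ℕ n)) (z /ℕ n) (+ n) ⟩
    (z /ℕ n) * + n                          ∎))
    where
    open ≡-Reasoning
    lemma : ∀ r q m → r + q * m - r ≡ q * m
    lemma = solve-∀

  toℕ-≈-injective : ∀ {i j : Fin n} → + toℕ i ≈ + toℕ j → i ≡ j
  toℕ-≈-injective {i} {j} i≈j =
    Fin.toℕ-injective (ℤ.+-injective (ℤ.i-j≡0⇒i≡j _ _ (ℤ.∣i∣≡0⇒i≡0 distance≡0)))
    where
    distance : ℕ
    distance = ∣ + toℕ i - + toℕ j ∣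
    distance<n : distance ℕ.< n
    distance<n = subst (ℕ._< n) (cong ∣_∣ (sym (ℤ.m-n≡m⊖n (toℕ i) (toℕ j))))
      (ℕ.≤-<-trans (ℤ.∣m⊝n∣≤m⊔n (toℕ i) (toℕ j)) (ℕ.⊔-lub (Fin.toℕ<n i) (Fin.toℕ<n j)))
    distance≡0 : distance ≡ 0
    distance≡0 = trans (sym (m<n⇒m%n≡m distance<n)) (n∣m⇒m%n≡0 distance n (≈⇒∣ i≈j))

  ≈⇒residue≡ : ∀ {z i} → z ≈ + toℕ i → residue z ≡ i
  ≈⇒residue≡ {z} z≈i = toℕ-≈-injective (≈-trans (≈-sym (residue-≈ z)) z≈i)

  residue≡⇒≈ : ∀ z {i} → residue z ≡ i → z ≈ + toℕ i
  residue≡⇒≈ z refl = residue-≈ z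

  coprime⇒invertible : ∀ z → Coprime ∣ z ∣ n → ∃ λ w → w * z ≈ 1ℤ
  coprime⇒invertible z z⊥n with coprime-Bézout (≈-coprime (residue-≈ z) z⊥n)
  ... | Bézout.+- x y eq = + x , ≈-trans (*-cong (≈-refl {+ x}) (residue-≈ z)) (mk≈ (divides (+ y) (begin
      + x * + r - 1ℤ       ≡⟨ cong (_- 1ℤ) (pos-1+*≡* y n x r eq) ⟨
      1ℤ + + y * + n - 1ℤ  ≡⟨ lemma (+ y * + n) ⟩
      + y * + n            ∎)))
    where
    open ≡-Reasoning
    r : ℕ
    r = toℕ (residue z)
    lemma : ∀ m → 1ℤ + m - 1ℤ ≡ m
    lemma = solve-∀
  ... | Bézout.-+ x y eq = - + x , ≈-trans (*-cong (≈-refl { - + x}) (residue-≈ z)) (mk≈ (divides (- + y) (begin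
      - + x * + r - 1ℤ      ≡⟨ lemma₁ (+ x) (+ r) ⟩
      - (1ℤ + + x * + r)    ≡⟨ cong -_ (pos-1+*≡* x r y n eq) ⟩
      - (+ y * + n)         ≡⟨ lemma₂ (+ y) (+ n) ⟩
      - + y * + n           ∎)))
    where
    open ≡-Reasoning
    r : ℕ
    r = toℕ (residue z)
    lemma₁ : ∀ a b → - a * b - 1ℤ ≡ - (1ℤ + a * b)
    lemma₁ = solve-∀
    lemma₂ : ∀ a b → - (a * b) ≡ - a * b
    lemma₂ = solve-∀

  evalMono-cong : ∀ {k} (e : Vec ℕ k) {xs ys} → Pointwise _≈_ xs ys → evalMono e xs ≈ evalMono e ys
  evalMono-cong []      []             = ≈-refl
  evalMono-cong (d ∷ e) (x≈y ∷ xs≈ys) = *-cong (^ℤ-cong d x≈y) (evalMono-cong e xs≈ys)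

  eval-cong : ∀ {k} (f : Poly k) {xs ys} → Pointwise _≈_ xs ys → eval f xs ≈ eval f ys
  eval-cong []            xs≈ys = ≈-refl
  eval-cong ((c , e) ∷ f) xs≈ys = +-cong (*-cong (≈-refl {c}) (evalMono-cong e xs≈ys)) (eval-cong f xs≈ys)

  scale : ∀ {k} → ℤ → Vec (Fin n) k → Vec (Fin n) k
  scale u = Vec.map (λ i → residue (u * + toℕ i))

  lift-scale : ∀ {k} u (x : Vec (Fin n) k) → Pointwise _≈_ (lift (scale u x)) (Vec.map (u *_) (lift x))
  lift-scale u []      = []
  lift-scale u (i ∷ x) = ≈-sym (residue-≈ (u * + toℕ i)) ∷ lift-scale u x

  scale-inverse : ∀ {k} u v → v * u ≈ 1ℤ → (x : Vec (Fin n) k) → scale v (scale u x) ≡ x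
  scale-inverse u v vu≈1 []      = refl
  scale-inverse u v vu≈1 (i ∷ x) = cong₂ _∷_ (≈⇒residue≡ (begin
    v * + toℕ (residue (u * + toℕ i)) ≈⟨ *-cong (≈-refl {v}) (residue-≈ (u * + toℕ i)) ⟨
    v * (u * + toℕ i)                 ≡⟨ ℤ.*-assoc v u _ ⟨
    v * u * + toℕ i                   ≈⟨ *-cong vu≈1 ≈-refl ⟩
    1ℤ * + toℕ i                      ≡⟨ ℤ.*-identityˡ _ ⟩
    + toℕ i                           ∎)) (scale-inverse u v vu≈1 x)
    where open ≈-Reasoning

  eval-scale-≈ : ∀ {k d} {f : Poly k} → HomogeneousOfDegree d f → ∀ u x →
    eval f (lift (scale u x)) ≈ u ^ℤ d * eval f (lift x)
  eval-scale-≈ {f = f} hom u x = ≈-trans (eval-cong f (lift-scale u x)) (≈-reflexive (eval-scale hom u (lift x)))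

  coprime-scale : ∀ {k} u {f : Poly k} → Coprime ∣ u ∣ n → Homogeneous f → ∀ x →
    (Coprime ∣ eval f (lift (scale u x)) ∣ n) ⇔ (Coprime ∣ eval f (lift x) ∣ n)
  coprime-scale u {f} u⊥n (d , hom) x = mk⇔ scaled⇒unscaled unscaled⇒scaled
    where
    scaled⇒unscaled : Coprime ∣ eval f (lift (scale u x)) ∣ n → Coprime ∣ eval f (lift x) ∣ n
    scaled⇒unscaled fux⊥n = coprime-*⁻ (u ^ℤ d) _ (≈-coprime (eval-scale-≈ hom u x) fux⊥n)
    unscaled⇒scaled : Coprime ∣ eval f (lift x) ∣ n → Coprime ∣ eval f (lift (scale u x)) ∣ n
    unscaled⇒scaled fx⊥n =
      ≈-coprime (≈-sym (eval-scale-≈ hom u x)) (coprime-*⁺ (u ^ℤ d) _ (coprime-^ℤ u d u⊥n) fx⊥n)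

  allCoprime-scale : ∀ {k} u {G : List (Poly k)} → Coprime ∣ u ∣ n → All Homogeneous G → ∀ x →
    AllCoprime n G (lift (scale u x)) ⇔ AllCoprime n G (lift x)
  allCoprime-scale {k} u u⊥n G-homogeneous x = mk⇔
    (λ cop → All.zipWith {P = Homogeneous} {Q = CoprimeAt (scale u x)} {R = CoprimeAt x}
                         (λ (hom , c) → Equivalence.to (coprime-scale u u⊥n hom x) c) (G-homogeneous , cop))
    (λ cop → All.zipWith {P = Homogeneous} {Q = CoprimeAt x} {R = CoprimeAt (scale u x)}
                         (λ (hom , c) → Equivalence.from (coprime-scale u u⊥n hom x) c) (G-homogeneous , cop))
    where
    CoprimeAt : Vec (Fin n) k → Poly k → Set
    CoprimeAt y f = Coprime ∣ eval f (lift y) ∣ n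

module Solutions {k} (F : List (Poly k)) (F-homogeneous : All Homogeneous F) (a : Vec ℤ k)
                 (n : ℕ) .{{_ : NonZero n}} where

  open Modulo n

  L : Vec (Fin n) k → ℤ
  L x = eval (linear a) (lift x)

  -- The predicate filtered by gCount, so gCount F a c n unfolds to count (solution? c) (tuples k n).
  Solution : ℤ → Pred (Vec (Fin n) k) 0ℓ
  Solution c x = n ℕ.∣ ∣ L x - c ∣ × AllCoprime n F (lift x)

  solution? : ∀ c → Decidable (Solution c)
  solution? c x = (n ∣? ∣ L x - c ∣) ×-dec allCoprime? n F (lift x)

  L-scale : ∀ u x → L (scale u x) ≈ u * L x
  L-scale u x = ≈-trans (eval-scale-≈ (linear-homogeneous a) u x) (*-cong (≈-reflexive (ℤ.*-identityʳ u)) ≈-refl)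

  solution-scale : ∀ u c → Coprime ∣ u ∣ n → (Solution (u * c) ∘ scale u) ≐ Solution c
  solution-scale u c u⊥n = scaled⇒solution , solution⇒scaled
    where
    open ≈-Reasoning
    scaled⇒solution : Solution (u * c) ∘ scale u ⊆ Solution c
    scaled⇒solution {x} (n∣Lux-uc , cop) = ≈⇒∣ (*-cancelˡ-coprime u u⊥n (begin
      u * L x       ≈⟨ L-scale u x ⟨
      L (scale u x) ≈⟨ ∣⇒≈ n∣Lux-uc ⟩
      u * c         ∎)) , Equivalence.to (allCoprime-scale u u⊥n F-homogeneous x) cop
    solution⇒scaled : Solution c ⊆ Solution (u * c) ∘ scale u
    solution⇒scaled {x} (n∣Lx-c , cop) = ≈⇒∣ (begin
      L (scale u x) ≈⟨ L-scale u x ⟩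
      u * L x       ≈⟨ *-cong (≈-refl {u}) (∣⇒≈ n∣Lx-c) ⟩
      u * c         ∎) , Equivalence.from (allCoprime-scale u u⊥n F-homogeneous x) cop

  gCount-scale : ∀ u c → Coprime ∣ u ∣ n → gCount F a (u * c) n ≡ gCount F a c n
  gCount-scale u c u⊥n with v , vu≈1 ← coprime⇒invertible u u⊥n = begin
    count (solution? (u * c)) (tuples k n)
      ≡⟨ count-bijection (solution? (u * c)) (tuples-unique k n) ∈-tuples
                         (scale u) (scale v) (scale-inverse u v vu≈1) (scale-inverse v u uv≈1) ⟩
    count (solution? (u * c) ∘ scale u) (tuples k n)
      ≡⟨ count-cong _ (solution? c) (solution-scale u c u⊥n) (tuples k n) ⟩
    count (solution? c) (tuples k n) ∎
    where
    open ≡-Reasoning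
    uv≈1 : u * v ≈ 1ℤ
    uv≈1 = ≈-trans (≈-reflexive (ℤ.*-comm u v)) vu≈1

  gCount-coprime : ∀ c → Coprime ∣ c ∣ n → gCount F a c n ≡ gCount F a 1ℤ n
  gCount-coprime c c⊥n = trans (cong (λ c → gCount F a c n) (sym (ℤ.*-identityʳ c))) (gCount-scale c 1ℤ c⊥n)

  Admissible : Pred (Vec (Fin n) k) 0ℓ
  Admissible x = AllCoprime n (F ++ [ linear a ]) (lift x)

  admissible? : Decidable Admissible
  admissible? x = allCoprime? n (F ++ [ linear a ]) (lift x)

  residue-fibre : ∀ i → count (λ x → admissible? x ×-dec (residue (L x) Fin.≟ i)) (tuples k n)
                        ≡ indicator (coprime? (toℕ i) n) ℕ.* gCount F a 1ℤ n
  residue-fibre i = by-coprimality (coprime? (toℕ i) n)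
    where
    Fibre : Pred (Vec (Fin n) k) 0ℓ
    Fibre x = Admissible x × residue (L x) ≡ i
    fibre? : Decidable Fibre
    fibre? x = admissible? x ×-dec (residue (L x) Fin.≟ i)
    by-coprimality : (i⊥n? : Dec (Coprime (toℕ i) n)) →
                     count fibre? (tuples k n) ≡ indicator i⊥n? ℕ.* gCount F a 1ℤ n
    by-coprimality (yes i⊥n) = begin
      count fibre? (tuples k n)
        ≡⟨ count-cong fibre? (solution? (+ toℕ i)) (fibre⇒solution , solution⇒fibre) (tuples k n) ⟩
      gCount F a (+ toℕ i) n    ≡⟨ gCount-coprime (+ toℕ i) i⊥n ⟩
      gCount F a 1ℤ n           ≡⟨ ℕ.*-identityˡ _ ⟨
      1 ℕ.* gCount F a 1ℤ n     ∎
      where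
      open ≡-Reasoning
      fibre⇒solution : Fibre ⊆ Solution (+ toℕ i)
      fibre⇒solution {x} (cop , Lx↦i) = ≈⇒∣ (residue≡⇒≈ (L x) Lx↦i) , proj₁ (All.++⁻ F cop)
      solution⇒fibre : Solution (+ toℕ i) ⊆ Fibre
      solution⇒fibre {x} (n∣Lx-i , cop) = All.++⁺ cop (≈-coprime (≈-sym Lx≈i) i⊥n ∷ []) , ≈⇒residue≡ Lx≈i
        where
        Lx≈i : L x ≈ + toℕ i
        Lx≈i = ∣⇒≈ n∣Lx-i
    by-coprimality (no ¬i⊥n) = count-none fibre? (All.universal empty-fibre (tuples k n))
      where
      empty-fibre : ∀ x → ¬ Fibre x
      empty-fibre x (cop , Lx↦i) with _ , Lx⊥n ∷ [] ← All.++⁻ F cop =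
        ¬i⊥n (≈-coprime (residue≡⇒≈ (L x) Lx↦i) Lx⊥n)

  phiG-by-residue : phiG (F ++ [ linear a ]) n ≡ totient n ℕ.* gCount F a 1ℤ n
  phiG-by-residue = begin
    count admissible? (tuples k n)
      ≡⟨ count-partition Fin._≟_ admissible? (residue ∘ L) (Unique.allFin⁺ n) ∈-allFin (tuples k n) ⟩
    sum (map (λ i → count (λ x → admissible? x ×-dec (residue (L x) Fin.≟ i)) (tuples k n)) (allFin n))
      ≡⟨ cong sum (map-cong residue-fibre (allFin n)) ⟩
    sum (map (λ i → indicator (coprime? (toℕ i) n) ℕ.* gCount F a 1ℤ n) (allFin n))
      ≡⟨ sum-indicator-* (λ i → coprime? (toℕ i) n) (gCount F a 1ℤ n) (allFin n) ⟩
    totient n ℕ.* gCount F a 1ℤ n ∎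
    where open ≡-Reasoning

mainTheorem12 : (k : ℕ) (F : List (Poly k)) → All Homogeneous F →
    (a : Vec ℤ k) (n : ℕ) → 1 ≤ n → (b : ℤ) → Coprime ∣ b ∣ n →
    gCount F a b n ℕ.* totient n ≡ phiG (F ++ [ linear a ]) n
mainTheorem12 k F F-homogeneous a n 1≤n b b⊥n = begin
  gCount F a b n ℕ.* totient n   ≡⟨ cong (ℕ._* totient n) (gCount-coprime b b⊥n) ⟩
  gCount F a 1ℤ n ℕ.* totient n  ≡⟨ ℕ.*-comm (gCount F a 1ℤ n) (totient n) ⟩
  totient n ℕ.* gCount F a 1ℤ n  ≡⟨ phiG-by-residue ⟨
  phiG (F ++ [ linear a ]) n     ∎
  where
  open ≡-Reasoning
  instance
    n≢0 : NonZero n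
    n≢0 = >-nonZero 1≤n
  open Solutions F F-homogeneous a n
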